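{- Let $d\ge2$, $X=\{0,\dots,d-1\}$, and let $G\le\mathrm{Aut}(X^*)$ be a recurrent group whose action on $X$ is doubly transitive. Then for all $n\ge0$, all $w\in X^n$ and all $i,j\in X$ with $i\ne j$, there exists $g\in G$ acting trivially on $X^n$ such that $g|_w(i)=j$. -}

module Defs where

open import Data.Nat using (ℕ)
open import Data.Fin using (Fin)
open import Data.List using (List; []; _∷_; _++_; length)
open import Data.Product using (Σ; _×_; _,_)
open import Data.Fin.Permutation as P using (Permutation′; _⟨$⟩ʳ_; _⟨$⟩ˡ_; _∘ₚ_; flip)
open import Relation.Binary.PropositionalEquality using (_≡_; _≢_)

Word : ℕ → Set
Word d = List (Fin d)

-- An automorphism of the rooted tree X* is given by its portrait:
-- a permutation of X at every vertex (this is a bijective encoding of Aut(X*)).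
Aut : ℕ → Set
Aut d = Word d → Permutation′ d

module _ {d : ℕ} where

  root : Aut d → Permutation′ d
  root g = g []

  -- the section (restriction) g|_w, defined by g(wv) = g(w) g|_w(v)
  section : Aut d → Word d → Aut d
  section g w v = g (w ++ v)

  act : Aut d → Word d → Word d
  act g []      = []
  act g (x ∷ w) = (root g ⟨$⟩ʳ x) ∷ act (section g (x ∷ [])) w

  _≈_ : Aut d → Aut d → Set
  g ≈ h = ∀ w → g w P.≈ h w

  -- group operations of Aut(X*) (left action: (g · h)(v) = g(h(v)))
  e : Aut d
  e _ = P.id

  _·_ : Aut d → Aut d → Aut d
  (g · h) w = h w ∘ₚ g (act h w)

  inv : Aut d → Aut d
  inv g []      = flip (root g)
  inv g (x ∷ w) = inv (section g ((root g ⟨$⟩ˡ x) ∷ [])) w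

  record Subgroup : Set₁ where
    field
      _∈G       : Aut d → Set
      ∈-resp-≈  : ∀ {g h} → g ≈ h → g ∈G → h ∈G
      e∈G       : e ∈G
      ·∈G       : ∀ {g h} → g ∈G → h ∈G → (g · h) ∈G
      inv∈G     : ∀ {g} → g ∈G → inv g ∈G
  open Subgroup public

  SelfSimilar : Subgroup → Set
  SelfSimilar G = ∀ g (x : Fin d) → _∈G G g → _∈G G (section g (x ∷ []))

  TransitiveOnX : Subgroup → Set
  TransitiveOnX G = ∀ (x y : Fin d) → Σ (Aut d) λ g → _∈G G g × (root g ⟨$⟩ʳ x ≡ y)

  DoublyTransitiveOnX : Subgroup → Set
  DoublyTransitiveOnX G =
    ∀ (x₁ x₂ y₁ y₂ : Fin d) → x₁ ≢ x₂ → y₁ ≢ y₂ →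
    Σ (Aut d) λ g → _∈G G g × (root g ⟨$⟩ʳ x₁ ≡ y₁) × (root g ⟨$⟩ʳ x₂ ≡ y₂)

  -- recurrent (= self-replicating, Nekrashevych Def. 2.8.1): self-similar,
  -- transitive on X, and for every letter x the map St_G(x) → G, g ↦ g|_x, is onto
  Recurrent : Subgroup → Set
  Recurrent G =
    SelfSimilar G × TransitiveOnX G ×
    (∀ (x : Fin d) (h : Aut d) → _∈G G h →
      Σ (Aut d) λ g → _∈G G g × (root g ⟨$⟩ʳ x ≡ x) × (section g (x ∷ []) ≈ h))

  TrivialOnLevel : ℕ → Aut d → Set
  TrivialOnLevel n g = ∀ (v : Word d) → length v ≡ n → act g v ≡ v

-- Fix τ ∈ G moving a letter x. Iterating recurrence gives r m ∈ G acting as x^m q ↦ x^m τ(q).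
-- Level n carries only finitely many actions, so some r a, r b with a < b agree on it: then
-- r a⁻¹ r b is trivial on level n but moves x^b, and passing to sections yields f ∈ G trivial on
-- level n that moves a vertex p a on level n + 1, to p b say.  Recurrence with double
-- transitivity gives c ∈ G sending p a, p b to w i, w j, and c f c⁻¹ is the required element.
module Submission where

open import Defs
open import Data.Nat using (ℕ; zero; suc; _+_; _<_; _≥_; s≤s; z≤n)
open import Data.Nat.Properties using (suc-injective; +-comm; +-suc; +-monoˡ-<; n<1+n; m≤n⇒∃[o]m+o≡n)
open import Data.Fin using (Fin; toℕ) renaming (zero to fzero; suc to fsuc)
open import Data.Fin.Properties using (pigeonhole; ∀-cons; 0≢1+n; _≟_)
open import Data.Fin.Permutation using (_⟨$⟩ʳ_; _⟨$⟩ˡ_; inverseˡ; inverseʳ)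
open import Data.List using (List; []; _∷_; [_]; _++_; _∷ʳ_; length; map; replicate; lookup; allFin; cartesianProductWith; initLast; _∷ʳ′_)
open import Data.List.Properties using (∷-injectiveˡ; ∷-injectiveʳ; ∷ʳ-injectiveʳ; ++-cancelˡ; ++-identityʳ; length-++; length-replicate; length-map)
open import Data.List.Membership.Propositional using (_∈_)
open import Data.List.Membership.Propositional.Properties using (∈-allFin; ∈-map⁻; ∈-cartesianProductWith⁺; ∈-cartesianProductWith⁻)
open import Data.List.Relation.Binary.Subset.Propositional using (_⊆_)
open import Data.List.Relation.Unary.Any using (here; there; index)
open import Data.List.Relation.Unary.Any.Properties using (lookup-index)
open import Data.Product using (Σ; ∃; ∃₂; _×_; _,_; proj₁; proj₂)
open import Data.Sum using (_⊎_; inj₁; inj₂)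
import Data.Sum as Sum
open import Function using (_∘_)
open import Relation.Nullary using (yes; no)
open import Relation.Binary.PropositionalEquality using (_≡_; _≢_; refl; sym; trans; cong; cong₂; subst; module ≡-Reasoning)
open ≡-Reasoning

module _ {A : Set} where

  replicate-+ : ∀ m n (x : A) → replicate (m + n) x ≡ replicate m x ++ replicate n x
  replicate-+ zero    n x = refl
  replicate-+ (suc m) n x = cong (x ∷_) (replicate-+ m n x)

  length-∷ʳ : ∀ (xs : List A) x → length (xs ∷ʳ x) ≡ suc (length xs)
  length-∷ʳ xs x = trans (length-++ xs) (+-comm (length xs) 1)

  map-agree : ∀ {B : Set} {f g : A → B} {xs x} → map f xs ≡ map g xs → x ∈ xs → f x ≡ g x
  map-agree {xs = _ ∷ _} eq (here refl) = ∷-injectiveˡ eq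
  map-agree {xs = _ ∷ _} eq (there x∈) = map-agree (∷-injectiveʳ eq) x∈

  lists : List A → ℕ → List (List A)
  lists B zero    = [ [] ]
  lists B (suc m) = cartesianProductWith _∷_ B (lists B m)

  ∈-lists : ∀ B (xs : List A) → xs ⊆ B → xs ∈ lists B (length xs)
  ∈-lists B []       _    = here refl
  ∈-lists B (x ∷ xs) xs⊆B = ∈-cartesianProductWith⁺ _∷_ (xs⊆B (here refl)) (∈-lists B xs (xs⊆B ∘ there))

  length-∈-lists : ∀ B m {xs} → xs ∈ lists B m → length xs ≡ m
  length-∈-lists B zero (here refl) = refl
  length-∈-lists B (suc m) xs∈
    with _ , _ , _ , ys∈ , refl ← ∈-cartesianProductWith⁻ _∷_ B (lists B m) xs∈
    = cong suc (length-∈-lists B m ys∈)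

  pigeonhole-∈ : ∀ (L : List A) (f : ℕ → A) → (∀ k → f k ∈ L) → ∃₂ λ i j → i < j × f i ≡ f j
  pigeonhole-∈ L f f∈L
    with i , j , i<j , same ← pigeonhole (n<1+n (length L)) (λ i → index (f∈L (toℕ i)))
    = toℕ i , toℕ j , i<j , (begin
      f (toℕ i)                      ≡⟨ lookup-index (f∈L (toℕ i)) ⟩
      lookup L (index (f∈L (toℕ i))) ≡⟨ cong (lookup L) same ⟩
      lookup L (index (f∈L (toℕ j))) ≡⟨ sym (lookup-index (f∈L (toℕ j))) ⟩
      f (toℕ j)                      ∎)

∀⊎∃ : ∀ {k} {P Q : Fin k → Set} → (∀ i → P i ⊎ Q i) → (∀ i → P i) ⊎ ∃ Q
∀⊎∃ {zero}  _  = inj₁ λ ()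
∀⊎∃ {suc k} pq with pq fzero | ∀⊎∃ (pq ∘ fsuc)
... | inj₂ q  | _            = inj₂ (fzero , q)
... | inj₁ _  | inj₂ (i , q) = inj₂ (fsuc i , q)
... | inj₁ p  | inj₁ ps      = inj₁ (∀-cons p ps)

module _ {d : ℕ} where

  act-cong : ∀ {g h : Aut d} → g ≈ h → ∀ v → act g v ≡ act h v
  act-cong g≈h []      = refl
  act-cong g≈h (x ∷ v) = cong₂ _∷_ (g≈h [] x) (act-cong (λ w → g≈h (x ∷ w)) v)

  length-act : ∀ (g : Aut d) v → length (act g v) ≡ length v
  length-act g []      = refl
  length-act g (x ∷ v) = cong suc (length-act _ v)

  act-· : ∀ (g h : Aut d) v → act (g · h) v ≡ act g (act h v)
  act-· g h []      = refl
  act-· g h (x ∷ v) = cong (_ ∷_) (act-· _ _ v)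

  act-invˡ : ∀ (g : Aut d) v → act (inv g) (act g v) ≡ v
  act-invˡ g []      = refl
  act-invˡ g (x ∷ v) = cong₂ _∷_ (inverseˡ (root g)) (begin
    act (inv (section g [ root g ⟨$⟩ˡ (root g ⟨$⟩ʳ x) ])) (act (section g [ x ]) v)
      ≡⟨ cong (λ z → act (inv (section g [ z ])) (act (section g [ x ]) v)) (inverseˡ (root g)) ⟩
    act (inv (section g [ x ])) (act (section g [ x ]) v)
      ≡⟨ act-invˡ (section g [ x ]) v ⟩
    v ∎)

  act-invʳ : ∀ (g : Aut d) v → act g (act (inv g) v) ≡ v
  act-invʳ g []      = refl
  act-invʳ g (x ∷ v) = cong₂ _∷_ (inverseʳ (root g)) (act-invʳ _ v)

  act-++ : ∀ (g : Aut d) p q → act g (p ++ q) ≡ act g p ++ act (section g p) q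
  act-++ g []      q = refl
  act-++ g (x ∷ p) q = cong (_ ∷_) (act-++ _ p q)

  act-∷ʳ : ∀ (g : Aut d) {p} → act g p ≡ p → ∀ a → act g (p ∷ʳ a) ≡ p ∷ʳ (root (section g p) ⟨$⟩ʳ a)
  act-∷ʳ g {p} gp≡p a = trans (act-++ g p [ a ]) (cong (_++ [ root (section g p) ⟨$⟩ʳ a ]) gp≡p)

  fixed-by-inv⇒fixed : ∀ (g : Aut d) {v} → act (inv g) v ≡ v → act g v ≡ v
  fixed-by-inv⇒fixed g {v} eq = trans (cong (act g) (sym eq)) (act-invʳ g v)

  act-conj : ∀ (c f : Aut d) v → act (c · (f · inv c)) (act c v) ≡ act c (act f v)
  act-conj c f v = begin
    act (c · (f · inv c)) (act c v)       ≡⟨ act-· c _ _ ⟩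
    act c (act (f · inv c) (act c v))     ≡⟨ cong (act c) (act-· f (inv c) _) ⟩
    act c (act f (act (inv c) (act c v))) ≡⟨ cong (act c ∘ act f) (act-invˡ c v) ⟩
    act c (act f v)                       ∎

  words : ℕ → List (Word d)
  words = lists (allFin d)

  ∈-words : ∀ {n} v → length v ≡ n → v ∈ words n
  ∈-words v refl = ∈-lists (allFin d) v (λ {z} _ → ∈-allFin z)

  levelAction : Aut d → ℕ → List (Word d)
  levelAction g n = map (act g) (words n)

  levelAction-finite : ∀ g n → levelAction g n ∈ lists (words n) (length (words n))
  levelAction-finite g n =
    subst (λ m → levelAction g n ∈ lists (words n) m) (length-map (act g) (words n))
      (∈-lists (words n) (levelAction g n) images)
    where
      images : levelAction g n ⊆ words n
      images gv∈ with v , v∈ , refl ← ∈-map⁻ (act g) gv∈ =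
        ∈-words (act g v) (trans (length-act g v) (length-∈-lists (allFin d) n v∈))

  levelAction-agree : ∀ {g h n} → levelAction g n ≡ levelAction h n → ∀ v → length v ≡ n → act g v ≡ act h v
  levelAction-agree same v len = map-agree same (∈-words v len)

  MovesOnLevel : ℕ → Aut d → Set
  MovesOnLevel m g = Σ (Word d) λ v → length v ≡ m × act g v ≢ v

  trivialOnLevel-conj : ∀ {n f} (c : Aut d) → TrivialOnLevel n f → TrivialOnLevel n (c · (f · inv c))
  trivialOnLevel-conj {n} {f} c f-triv v len = begin
    act (c · (f · inv c)) v                       ≡⟨ cong (act (c · (f · inv c))) (sym (act-invʳ c v)) ⟩
    act (c · (f · inv c)) (act c (act (inv c) v)) ≡⟨ act-conj c f _ ⟩
    act c (act f (act (inv c) v))                 ≡⟨ cong (act c) (f-triv _ (trans (length-act (inv c) v) len)) ⟩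
    act c (act (inv c) v)                         ≡⟨ act-invʳ c v ⟩
    v                                             ∎

  trivialOnLevel-suc⁻ : ∀ {n} {g : Aut d} → TrivialOnLevel (suc n) g → ∀ z →
    root g ⟨$⟩ʳ z ≡ z × TrivialOnLevel n (section g [ z ])
  trivialOnLevel-suc⁻ {n} g-triv z =
    ∷-injectiveˡ (g-triv (z ∷ replicate n z) (cong suc (length-replicate n))) ,
    λ v len → ∷-injectiveʳ (g-triv (z ∷ v) (cong suc len))

  trivialOnLevel-suc⁺ : ∀ {n} {g : Aut d} → (∀ z → root g ⟨$⟩ʳ z ≡ z × TrivialOnLevel n (section g [ z ])) →
    TrivialOnLevel (suc n) g
  trivialOnLevel-suc⁺ triv (z ∷ v) len with gz≡z , g|z-triv ← triv z =
    cong₂ _∷_ gz≡z (g|z-triv v (suc-injective len))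

  trivialOnLevel⊎moves : ∀ n (g : Aut d) → TrivialOnLevel n g ⊎ MovesOnLevel n g
  trivialOnLevel⊎moves zero    g = inj₁ λ { [] _ → refl ; (_ ∷ _) () }
  trivialOnLevel⊎moves (suc n) g = Sum.map trivialOnLevel-suc⁺ proj₂ (∀⊎∃ atLetter)
    where
      atLetter : ∀ z → (root g ⟨$⟩ʳ z ≡ z × TrivialOnLevel n (section g [ z ])) ⊎ MovesOnLevel (suc n) g
      atLetter z with root g ⟨$⟩ʳ z ≟ z | trivialOnLevel⊎moves n (section g [ z ])
      ... | no gz≢z  | _                      = inj₂ (z ∷ replicate n z , cong suc (length-replicate n) , gz≢z ∘ ∷-injectiveˡ)
      ... | yes gz≡z | inj₁ g|z-triv          = inj₁ (gz≡z , g|z-triv)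
      ... | yes _    | inj₂ (v , len , moved) = inj₂ (z ∷ v , cong suc len , moved ∘ ∷-injectiveʳ)

module RecurrentGroup {d : ℕ} (G : Subgroup {d}) (recurrent : Recurrent G) where

  selfSimilar : SelfSimilar G
  selfSimilar = proj₁ recurrent

  transitive : TransitiveOnX G
  transitive = proj₁ (proj₂ recurrent)

  lift : ∀ (x : Fin d) h → _∈G G h → Σ (Aut d) λ g → _∈G G g × (root g ⟨$⟩ʳ x ≡ x) × (section g [ x ] ≈ h)
  lift = proj₂ (proj₂ recurrent)

  -- τ moves z to y and σ fixes y with σ|_y = h τ|_z⁻¹, so σ τ moves z to y with section h at z.
  lift-letter : ∀ z y {h} → _∈G G h → Σ (Aut d) λ g → _∈G G g × (∀ q → act g (z ∷ q) ≡ y ∷ act h q)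
  lift-letter z y {h} h∈
    with τ , τ∈ , τz≡y ← transitive z y
    with σ , σ∈ , σy≡y , σ|y≈ ← lift y (h · inv (section τ [ z ])) (·∈G G h∈ (inv∈G G (selfSimilar τ z τ∈)))
    = σ · τ , ·∈G G σ∈ τ∈ , λ q → begin
      act (σ · τ) (z ∷ q)
        ≡⟨ act-· σ τ (z ∷ q) ⟩
      act σ (act τ (z ∷ q))
        ≡⟨ cong (λ t → act σ (t ∷ act (section τ [ z ]) q)) τz≡y ⟩
      act σ (y ∷ act (section τ [ z ]) q)
        ≡⟨ cong₂ _∷_ σy≡y (act-cong σ|y≈ _) ⟩
      y ∷ act (h · inv (section τ [ z ])) (act (section τ [ z ]) q)
        ≡⟨ cong (y ∷_) (act-· h _ _) ⟩
      y ∷ act h (act (inv (section τ [ z ])) (act (section τ [ z ]) q))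
        ≡⟨ cong (λ t → y ∷ act h t) (act-invˡ (section τ [ z ]) q) ⟩
      y ∷ act h q ∎

  lift-word : ∀ p w → length p ≡ length w → ∀ {h} → _∈G G h →
    Σ (Aut d) λ g → _∈G G g × (∀ q → act g (p ++ q) ≡ w ++ act h q)
  lift-word []      []      _   {h} h∈ = h , h∈ , λ _ → refl
  lift-word (z ∷ p) (y ∷ w) len h∈
    with g′ , g′∈ , g′-acts ← lift-word p w (suc-injective len) h∈
    with g , g∈ , g-acts ← lift-letter z y g′∈
    = g , g∈ , λ q → trans (g-acts (p ++ q)) (cong (y ∷_) (g′-acts q))

  descend : ∀ {n} k {f} → _∈G G f → TrivialOnLevel n f → MovesOnLevel (k + suc n) f →
    Σ (Aut d) λ f′ → _∈G G f′ × TrivialOnLevel n f′ × MovesOnLevel (suc n) f′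
  descend zero    f∈ f-triv moves = _ , f∈ , f-triv , moves
  descend {n} (suc k) {f} f∈ f-triv (z ∷ u , len , moved) with trivialOnLevel⊎moves (suc n) f
  ... | inj₂ moves  = f , f∈ , f-triv , moves
  ... | inj₁ f-triv′ with fz≡z , f|z-triv ← trivialOnLevel-suc⁻ f-triv′ z
    = descend k (selfSimilar f z f∈) f|z-triv (u , suc-injective len , moved ∘ cong₂ _∷_ fz≡z)

  module _ {x : Fin d} {τ} (τ∈G : _∈G G τ) (τx≢x : root τ ⟨$⟩ʳ x ≢ x) where

    r-lift : ∀ m → Σ (Aut d) λ g → _∈G G g × (∀ q → act g (replicate m x ++ q) ≡ replicate m x ++ act τ q)
    r-lift m = lift-word (replicate m x) (replicate m x) refl τ∈G

    r : ℕ → Aut d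
    r m = proj₁ (r-lift m)

    r∈G : ∀ m → _∈G G (r m)
    r∈G m = proj₁ (proj₂ (r-lift m))

    r-acts : ∀ m q → act (r m) (replicate m x ++ q) ≡ replicate m x ++ act τ q
    r-acts m = proj₂ (proj₂ (r-lift m))

    r-fixes : ∀ m → act (r m) (replicate m x) ≡ replicate m x
    r-fixes m = begin
      act (r m) (replicate m x)        ≡⟨ cong (act (r m)) (sym (++-identityʳ _)) ⟩
      act (r m) (replicate m x ++ [])  ≡⟨ r-acts m [] ⟩
      replicate m x ++ []              ≡⟨ ++-identityʳ _ ⟩
      replicate m x                    ∎

    r-moves : ∀ {a b} → a < b → act (r a) (replicate b x) ≢ replicate b x
    r-moves {a} a<b fixed with k , refl ← m≤n⇒∃[o]m+o≡n a<b =
      τx≢x (∷-injectiveˡ (++-cancelˡ (replicate a x) _ _ (begin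
        replicate a x ++ act τ (x ∷ replicate k x)     ≡⟨ sym (r-acts a _) ⟩
        act (r a) (replicate a x ++ x ∷ replicate k x) ≡⟨ cong (act (r a)) (sym xᵇ) ⟩
        act (r a) (replicate (suc a + k) x)            ≡⟨ fixed ⟩
        replicate (suc a + k) x                        ≡⟨ xᵇ ⟩
        replicate a x ++ x ∷ replicate k x             ∎)))
      where
        xᵇ : replicate (suc a + k) x ≡ replicate a x ++ x ∷ replicate k x
        xᵇ = trans (cong (λ m → replicate m x) (sym (+-suc a k))) (replicate-+ a (suc k) x)

    stabiliser-moves-next-level : ∀ n →
      Σ (Aut d) λ f → _∈G G f × TrivialOnLevel n f × MovesOnLevel (suc n) f
    stabiliser-moves-next-level n
      with i , j , i<j , same ← pigeonhole-∈ _ (λ k → levelAction (r (k + suc n)) n) (λ k → levelAction-finite _ n)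
      = descend j (·∈G G (inv∈G G (r∈G a)) (r∈G b)) f-triv (replicate b x , length-replicate b , f-moves)
      where
        a = i + suc n
        b = j + suc n
        f = inv (r a) · r b
        f-triv : TrivialOnLevel n f
        f-triv v len = begin
          act f v                       ≡⟨ act-· (inv (r a)) (r b) v ⟩
          act (inv (r a)) (act (r b) v) ≡⟨ cong (act (inv (r a))) (sym (levelAction-agree same v len)) ⟩
          act (inv (r a)) (act (r a) v) ≡⟨ act-invˡ (r a) v ⟩
          v                             ∎
        f-moves : act f (replicate b x) ≢ replicate b x
        f-moves fixed = r-moves (+-monoˡ-< (suc n) i<j) (fixed-by-inv⇒fixed (r a) (begin
          act (inv (r a)) (replicate b x)             ≡⟨ cong (act (inv (r a))) (sym (r-fixes b)) ⟩
          act (inv (r a)) (act (r b) (replicate b x)) ≡⟨ sym (act-· (inv (r a)) (r b) _) ⟩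
          act f (replicate b x)                       ≡⟨ fixed ⟩
          replicate b x                               ∎))

  module _ (doublyTransitive : DoublyTransitiveOnX G) where

    transport-siblings : ∀ p w → length p ≡ length w → ∀ {a b i j} → a ≢ b → i ≢ j →
      Σ (Aut d) λ c → _∈G G c × act c (p ∷ʳ a) ≡ w ∷ʳ i × act c (p ∷ʳ b) ≡ w ∷ʳ j
    transport-siblings p w len {a} {b} {i} {j} a≢b i≢j
      with ρ , ρ∈ , ρa≡i , ρb≡j ← doublyTransitive a b i j a≢b i≢j
      with c , c∈ , c-acts ← lift-word p w len ρ∈
      = c , c∈ , trans (c-acts [ a ]) (cong (w ∷ʳ_) ρa≡i) , trans (c-acts [ b ]) (cong (w ∷ʳ_) ρb≡j)

    sibling-move⇒section-transitive : ∀ {n f} → _∈G G f → TrivialOnLevel n f → ∀ {p a b} → length p ≡ n → a ≢ b →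
      act f (p ∷ʳ a) ≡ p ∷ʳ b → ∀ w → length w ≡ n → ∀ i j → i ≢ j →
      Σ (Aut d) λ g → _∈G G g × TrivialOnLevel n g × (root (section g w) ⟨$⟩ʳ i ≡ j)
    sibling-move⇒section-transitive {n} {f} f∈ f-triv {p} {a} {b} lp a≢b f-acts w lw i j i≢j
      with c , c∈ , c-a , c-b ← transport-siblings p w (trans lp (sym lw)) a≢b i≢j
      = g , ·∈G G c∈ (·∈G G f∈ (inv∈G G c∈)) , g-triv , ∷ʳ-injectiveʳ w w (begin
        w ∷ʳ (root (section g w) ⟨$⟩ʳ i) ≡⟨ sym (act-∷ʳ g (g-triv w lw) i) ⟩
        act g (w ∷ʳ i)                   ≡⟨ cong (act g) (sym c-a) ⟩
        act g (act c (p ∷ʳ a))           ≡⟨ act-conj c f _ ⟩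
        act c (act f (p ∷ʳ a))           ≡⟨ cong (act c) f-acts ⟩
        act c (p ∷ʳ b)                   ≡⟨ c-b ⟩
        w ∷ʳ j                           ∎)
      where
        g = c · (f · inv c)
        g-triv : TrivialOnLevel n g
        g-triv = trivialOnLevel-conj c f-triv

    level-move⇒section-transitive : ∀ {n f} → _∈G G f → TrivialOnLevel n f → MovesOnLevel (suc n) f →
      ∀ w → length w ≡ n → ∀ i j → i ≢ j →
      Σ (Aut d) λ g → _∈G G g × TrivialOnLevel n g × (root (section g w) ⟨$⟩ʳ i ≡ j)
    level-move⇒section-transitive {n} {f} f∈ f-triv (v , len , moved) with initLast v
    ... | p ∷ʳ′ a = sibling-move⇒section-transitive f∈ f-triv lp a≢b f-acts
      where
        lp : length p ≡ n
        lp = suc-injective (trans (sym (length-∷ʳ p a)) len)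
        f-acts : act f (p ∷ʳ a) ≡ p ∷ʳ (root (section f p) ⟨$⟩ʳ a)
        f-acts = act-∷ʳ f (f-triv p lp) a
        a≢b : a ≢ root (section f p) ⟨$⟩ʳ a
        a≢b a≡b = moved (trans f-acts (cong (p ∷ʳ_) (sym a≡b)))

theorem5p14 : (d : ℕ) → d ≥ 2 → (G : Subgroup {d}) → Recurrent G → DoublyTransitiveOnX G →
    (n : ℕ) (w : Word d) → length w ≡ n → (i j : Fin d) → i ≢ j →
    Σ (Aut d) λ g → _∈G G g × TrivialOnLevel n g × (root (section g w) ⟨$⟩ʳ i ≡ j)
theorem5p14 (suc (suc _)) (s≤s (s≤s z≤n)) G recurrent doublyTransitive n =
  let τ , τ∈G , τ0≡1 = transitive fzero (fsuc fzero)
      f , f∈ , f-triv , moves = stabiliser-moves-next-level τ∈G (λ τ0≡0 → 0≢1+n (trans (sym τ0≡0) τ0≡1)) n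
  in level-move⇒section-transitive doublyTransitive f∈ f-triv moves
  where open RecurrentGroup G recurrent
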